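{- Suppose that the permutation class $\mathcal{C}$ is $(q,r)$-concentrated and $\pi\in\mathcal{C}$. Given a collection $\mathfrak{L}$ of $\ell\ge1$ horizontal or vertical lines through the plot of $\pi$, all but at most $r\ell$ entries of $\pi$ can be covered by $(q-1)\ell+1$ pairwise independent axis-parallel rectangles which do not intersect any line in $\mathfrak{L}$.
   Context: A permutation class is a set of permutations closed downward under containment. The plot of $\pi$ is $\{(i,\pi(i))\}$; lines never pass through points of the plot. Two axis-parallel rectangles are independent if both their $x$-axis projections and their $y$-axis projections are disjoint. A permutation is $(q,r)$-concentrated if for every horizontal or vertical line $L$, all but at most $r$ of its entries can be covered by $q$ pairwise independent axis-parallel rectangles not intersecting $L$; a class is $(q,r)$-concentrated if all its members are. -}

module Defs where

open import Data.Nat using (ℕ; _≤_; _<_; _+_; _*_; _∸_)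
open import Data.Fin using (Fin; toℕ)
import Data.Fin as F
open import Data.Fin.Permutation using (Permutation′; _⟨$⟩ʳ_)
open import Data.Fin.Subset using (Subset; _∉_; ∣_∣)
open import Data.List using (List; length; [_])
open import Data.List.Relation.Unary.All using (All)
open import Data.List.Relation.Unary.Any using (Any)
open import Data.List.Relation.Unary.AllPairs using (AllPairs)
open import Data.Product using (Σ; _×_; ∃)
open import Data.Sum using (_⊎_)
open import Function.Bundles using (_⇔_)

-- A permutation of length n: a bijection Fin n ↔ Fin n.
-- Its plot is {(toℕ i , toℕ (π ⟨$⟩ʳ i))}.
Perm : ℕ → Set
Perm = Permutation′

_≼_ : ∀ {k m} → Perm k → Perm m → Set
_≼_ {k} {m} σ π =
  Σ (Fin k → Fin m) λ f →
    (∀ i j → i F.< j → f i F.< f j) ×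
    (∀ i j → ((σ ⟨$⟩ʳ i) F.< (σ ⟨$⟩ʳ j)) ⇔ ((π ⟨$⟩ʳ f i) F.< (π ⟨$⟩ʳ f j)))

record PermClass : Set₁ where
  field
    member : ∀ {n} → Perm n → Set
    closed : ∀ {k m} (σ : Perm k) (π : Perm m) → σ ≼ π → member π → member σ
open PermClass public

-- Lines never pass through plot points (which have natural coordinates).
-- (vertical c) is the line x = c - 1/2, (horizontal c) is y = c - 1/2.
-- Every line avoiding the plot is equivalent (w.r.t. which points lie on
-- which side) to one of these.
data Line : Set where
  vertical   : ℕ → Line
  horizontal : ℕ → Line

-- Since only the plot
-- points matter, rectangles can be shrunk to the bounding box of the
-- points they cover, so integer corners lose no generality.
record Rect : Set where
  constructor rect
  field
    x₁ x₂ y₁ y₂ : ℕ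
    x₁≤x₂ : x₁ ≤ x₂
    y₁≤y₂ : y₁ ≤ y₂
open Rect public

Independent : Rect → Rect → Set
Independent R S =
  (x₂ R < x₁ S ⊎ x₂ S < x₁ R) × (y₂ R < y₁ S ⊎ y₂ S < y₁ R)

Avoids : Rect → Line → Set
Avoids R (vertical c)   = c ≤ x₁ R ⊎ x₂ R < c
Avoids R (horizontal c) = c ≤ y₁ R ⊎ y₂ R < c

Contains : Rect → ℕ → ℕ → Set
Contains R x y = (x₁ R ≤ x × x ≤ x₂ R) × (y₁ R ≤ y × y ≤ y₂ R)

Covered : ∀ {n} → Perm n → List Rect → Fin n → Set
Covered π Rs i = Any (λ R → Contains R (toℕ i) (toℕ (π ⟨$⟩ʳ i))) Rs

CoverableAvoiding : ∀ {n} → Perm n → List Line → (k s : ℕ) → Set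
CoverableAvoiding {n} π Ls k s =
  Σ (List Rect) λ Rs →
    length Rs ≤ k ×
    AllPairs Independent Rs ×
    All (λ R → All (Avoids R) Ls) Rs ×
    Σ (Subset n) λ E → ∣ E ∣ ≤ s × (∀ i → i ∉ E → Covered π Rs i)

Concentrated : ∀ {n} → (q r : ℕ) → Perm n → Set
Concentrated q r π = ∀ L → CoverableAvoiding π [ L ] q r

ConcentratedClass : (q r : ℕ) → PermClass → Set
ConcentratedClass q r 𝒞 = ∀ {n} (π : Perm n) → member 𝒞 π → Concentrated q r π

module Submission where

-- Given a cover avoiding the lines of 𝔏 and a cover by
-- at most q rectangles avoiding the new line L, at most one rectangle R of the
-- first cover meets L: two pairwise independent rectangles cannot both cross
-- the same line.  Replacing R by its intersections with the q rectangles of the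
-- second cover yields at most q − 1 extra rectangles, still pairwise
-- independent and avoiding every line, and only the entries missed by one of
-- the two covers stay uncovered.

open import Defs
open import Data.Nat using (ℕ; _≤_; _+_; _*_; _∸_)
open import Data.List using (List; length)

open import Data.Bool using (true; false)
open import Data.Fin.Properties using (toℕ≤n)
open import Data.Fin.Subset using (Subset; _∪_; ⊥; ∣_∣)
open import Data.Fin.Subset.Properties using (∣⊥∣≡0; x∈p∪q⁺)
open import Data.Fin.Permutation using (_⟨$⟩ʳ_)
open import Data.List using ([]; _∷_; _++_; [_]; mapMaybe; catMaybes)
open import Data.List.Properties using (length-++; length-mapMaybe)
open import Data.List.Relation.Unary.All as All using (All; []; _∷_)
import Data.List.Relation.Unary.All.Properties as All
open import Data.List.Relation.Unary.Any as Any using (Any; here; there)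
import Data.List.Relation.Unary.Any.Properties as Any
open import Data.List.Relation.Unary.AllPairs as AllPairs using (AllPairs; []; _∷_)
import Data.List.Relation.Unary.AllPairs.Properties as AllPairs
open import Data.Maybe using (Maybe; just; nothing)
import Data.Maybe.Relation.Unary.All as Maybe
import Data.Maybe.Relation.Unary.Any as MaybeAny
open import Data.Nat using (_<_; _⊔_; _⊓_; _≤?_; z≤n; s≤s; suc)
open import Data.Nat.Properties
open import Data.Nat.Tactic.RingSolver using (solve-∀)
open import Data.Product using (_×_; _,_; proj₁; proj₂; uncurry)
open import Data.Sum using (_⊎_; inj₁; inj₂)
open import Data.Vec using (_∷_; [])
open import Function using (_∘_)
open import Relation.Binary using (Rel)
open import Relation.Binary.PropositionalEquality using (_≡_; cong; sym)
open import Relation.Nullary using (¬_; Dec; yes; no; contradiction)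
open import Relation.Nullary.Decidable using (_⊎-dec_; _×-dec_)

record _⊑_ (T R : Rect) : Set where
  constructor mk⊑
  field
    left   : x₁ R ≤ x₁ T
    right  : x₂ T ≤ x₂ R
    bottom : y₁ R ≤ y₁ T
    top    : y₂ T ≤ y₂ R

⊑-refl : ∀ {R} → R ⊑ R
⊑-refl = mk⊑ ≤-refl ≤-refl ≤-refl ≤-refl

separated-shrink : ∀ {a b c d a′ b′ c′ d′} →
  a ≤ a′ → b′ ≤ b → c ≤ c′ → d′ ≤ d →
  b < c ⊎ d < a → b′ < c′ ⊎ d′ < a′
separated-shrink a≤ ≤b c≤ ≤d (inj₁ b<c) = inj₁ (≤-trans (s≤s ≤b) (≤-trans b<c c≤))
separated-shrink a≤ ≤b c≤ ≤d (inj₂ d<a) = inj₂ (≤-trans (s≤s ≤d) (≤-trans d<a a≤))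

avoids-shrink : ∀ {a b a′ b′ e} → a ≤ a′ → b′ ≤ b → e ≤ a ⊎ b < e → e ≤ a′ ⊎ b′ < e
avoids-shrink a≤ ≤b (inj₁ e≤a) = inj₁ (≤-trans e≤a a≤)
avoids-shrink a≤ ≤b (inj₂ b<e) = inj₂ (≤-trans (s≤s ≤b) b<e)

crossing⇒separated-avoids : ∀ {a b c d e} →
  ¬ (e ≤ a ⊎ b < e) → b < c ⊎ d < a → e ≤ c ⊎ d < e
crossing⇒separated-avoids {a} {b} {e = e} crosses separated with a <? e | e ≤? b
... | no a≮e  | _       = contradiction (inj₁ (≮⇒≥ a≮e)) crosses
... | _       | no e≰b  = contradiction (inj₂ (≰⇒> e≰b)) crosses
... | yes a<e | yes e≤b with separated
...   | inj₁ b<c = inj₁ (≤-trans e≤b (<⇒≤ b<c))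
...   | inj₂ d<a = inj₂ (<-trans d<a a<e)

Independent-⊑ : ∀ {T T′ R R′} → T ⊑ R → T′ ⊑ R′ → Independent R R′ → Independent T T′
Independent-⊑ (mk⊑ l r b t) (mk⊑ l′ r′ b′ t′) (x-sep , y-sep) =
  separated-shrink l r l′ r′ x-sep , separated-shrink b t b′ t′ y-sep

Avoids-⊑ : ∀ {T R} L → T ⊑ R → Avoids R L → Avoids T L
Avoids-⊑ (vertical c)   (mk⊑ l r _ _) = avoids-shrink l r
Avoids-⊑ (horizontal c) (mk⊑ _ _ b t) = avoids-shrink b t

independent-of-crossing⇒avoids : ∀ {R S} L → ¬ Avoids R L → Independent R S → Avoids S L
independent-of-crossing⇒avoids (vertical c)   crosses (x-sep , _) =
  crossing⇒separated-avoids crosses x-sep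
independent-of-crossing⇒avoids (horizontal c) crosses (_ , y-sep) =
  crossing⇒separated-avoids crosses y-sep

avoids? : ∀ R L → Dec (Avoids R L)
avoids? R (vertical c)   = (c ≤? x₁ R) ⊎-dec (suc (x₂ R) ≤? c)
avoids? R (horizontal c) = (c ≤? y₁ R) ⊎-dec (suc (y₂ R) ≤? c)

overlap? : ∀ R S → Dec ((x₁ R ⊔ x₁ S ≤ x₂ R ⊓ x₂ S) × (y₁ R ⊔ y₁ S ≤ y₂ R ⊓ y₂ S))
overlap? R S = (x₁ R ⊔ x₁ S ≤? x₂ R ⊓ x₂ S) ×-dec (y₁ R ⊔ y₁ S ≤? y₂ R ⊓ y₂ S)

_∩_ : Rect → Rect → Maybe Rect
R ∩ S with overlap? R S
... | yes (x≤ , y≤) = just (rect _ _ _ _ x≤ y≤)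
... | no _          = nothing

∩-⊑ : ∀ R S → Maybe.All (λ T → T ⊑ R × T ⊑ S) (R ∩ S)
∩-⊑ R S with overlap? R S
... | yes (_ , _) = Maybe.just ( mk⊑ (m≤m⊔n _ _) (m⊓n≤m _ _) (m≤m⊔n _ _) (m⊓n≤m _ _)
                               , mk⊑ (m≤n⊔m _ _) (m⊓n≤n _ _) (m≤n⊔m _ _) (m⊓n≤n _ _))
... | no _        = Maybe.nothing

∩-contains : ∀ {R S x y} → Contains R x y → Contains S x y →
  MaybeAny.Any (λ T → Contains T x y) (R ∩ S)
∩-contains {R} {S} ((rx₁ , rx₂) , (ry₁ , ry₂)) ((sx₁ , sx₂) , (sy₁ , sy₂))
  with overlap? R S
... | yes (_ , _) = MaybeAny.just ((⊔-lub rx₁ sx₁ , ⊓-glb rx₂ sx₂) , (⊔-lub ry₁ sy₁ , ⊓-glb ry₂ sy₂))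
... | no empty = contradiction
  ( ≤-trans (⊔-lub rx₁ sx₁) (⊓-glb rx₂ sx₂)
  , ≤-trans (⊔-lub ry₁ sy₁) (⊓-glb ry₂ sy₂)) empty

mapMaybe-AllPairs⁺ : ∀ {a b r s} {A : Set a} {B : Set b} {R : Rel A r} {S : Rel B s} (f : A → Maybe B) →
  (∀ {x y} → R x y → Maybe.All (λ u → Maybe.All (S u) (f y)) (f x)) →
  ∀ {xs} → AllPairs R xs → AllPairs S (mapMaybe f xs)
mapMaybe-AllPairs⁺ {S = S} f R⇒S = catMaybes⁺ ∘ AllPairs.map⁺ ∘ AllPairs.map R⇒S
  where
  catMaybes⁺ : ∀ {ms} → AllPairs (λ m m′ → Maybe.All (λ u → Maybe.All (S u) m′) m) ms →
    AllPairs S (catMaybes ms)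
  catMaybes⁺ []                     = []
  catMaybes⁺ {nothing ∷ _} (_ ∷ ps) = catMaybes⁺ ps
  catMaybes⁺ {just _ ∷ _}  (p ∷ ps) =
    All.All-catMaybes⁺ (All.map Maybe.drop-just p) ∷ catMaybes⁺ ps

clip : List Rect → Rect → List Rect
clip Ss R = mapMaybe (R ∩_) Ss

clip-⊑ : ∀ Ss R → All (_⊑ R) (clip Ss R)
clip-⊑ Ss R = All.mapMaybe⁺ (All.map⁺ (All.universal (Maybe.map proj₁ ∘ ∩-⊑ R) Ss))

clip-hereditary : ∀ {P : Rect → Set} {Ss} R → (∀ {T S} → T ⊑ S → P S → P T) →
  All P Ss → All P (clip Ss R)
clip-hereditary R P-⊑ ps =
  All.mapMaybe⁺ (All.map⁺ (All.map (λ {S} pS → Maybe.map (λ ⊑s → P-⊑ (proj₂ ⊑s) pS) (∩-⊑ R S)) ps))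

clip-pairwise : ∀ {Ss} R → AllPairs Independent Ss → AllPairs Independent (clip Ss R)
clip-pairwise R = mapMaybe-AllPairs⁺ (R ∩_) λ {S} {S′} indep →
  Maybe.map (λ ⊑s → Maybe.map (λ ⊑s′ → Independent-⊑ (proj₂ ⊑s) (proj₂ ⊑s′) indep) (∩-⊑ R S′))
            (∩-⊑ R S)

clip-covers : ∀ {Ss R x y} → Contains R x y → Any (λ S → Contains S x y) Ss →
  Any (λ T → Contains T x y) (clip Ss R)
clip-covers {Ss} {R} inR inSs = Any.mapMaybe⁺ (R ∩_) Ss (Any.map⁺ (Any.map (∩-contains inR) inSs))

-- Only the first rectangle crossing L is clipped: by independence no later one crosses L.
refine : Line → List Rect → List Rect → List Rect
refine L Ss []       = []
refine L Ss (R ∷ Rs) with avoids? R L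
... | yes _ = R ∷ refine L Ss Rs
... | no _  = clip Ss R ++ Rs

refine-length : ∀ {q L Ss} Rs → length Ss ≤ q → length (refine L Ss Rs) ≤ length Rs + (q ∸ 1)
refine-length []       _      = z≤n
refine-length {q} {L} {Ss} (R ∷ Rs) |Ss|≤q with avoids? R L
... | yes _ = s≤s (refine-length Rs |Ss|≤q)
... | no _  = begin
  length (clip Ss R ++ Rs)          ≡⟨ length-++ (clip Ss R) ⟩
  length (clip Ss R) + length Rs    ≤⟨ +-monoˡ-≤ (length Rs) (≤-trans (length-mapMaybe (R ∩_) Ss) |Ss|≤q) ⟩
  q + length Rs                     ≤⟨ +-monoˡ-≤ (length Rs) (m≤n+m∸n q 1) ⟩
  suc (q ∸ 1 + length Rs)           ≡⟨ cong suc (+-comm (q ∸ 1) (length Rs)) ⟩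
  suc (length Rs + (q ∸ 1))         ∎
  where open ≤-Reasoning

refine-hereditary : ∀ {P : Rect → Set} {L Ss Rs} → (∀ {T R} → T ⊑ R → P R → P T) →
  All P Rs → All P (refine L Ss Rs)
refine-hereditary P-⊑ [] = []
refine-hereditary {L = L} {Ss} {R ∷ Rs} P-⊑ (pR ∷ ps) with avoids? R L
... | yes _ = pR ∷ refine-hereditary P-⊑ ps
... | no _  = All.++⁺ (All.map (λ T⊑R → P-⊑ T⊑R pR) (clip-⊑ Ss R)) ps

refine-avoids : ∀ {L Ss Rs} → All (λ S → Avoids S L) Ss → AllPairs Independent Rs →
  All (λ T → Avoids T L) (refine L Ss Rs)
refine-avoids _ [] = []
refine-avoids {L} {Ss} {R ∷ Rs} avoidsSs (indR ∷ indRs) with avoids? R L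
... | yes avoidsR = avoidsR ∷ refine-avoids avoidsSs indRs
... | no crossesR = All.++⁺ (clip-hereditary R (Avoids-⊑ L) avoidsSs)
                            (All.map (independent-of-crossing⇒avoids L crossesR) indR)

refine-pairwise : ∀ {L Ss Rs} → AllPairs Independent Ss → AllPairs Independent Rs →
  AllPairs Independent (refine L Ss Rs)
refine-pairwise _ [] = []
refine-pairwise {L} {Ss} {R ∷ Rs} indSs (indR ∷ indRs) with avoids? R L
... | yes _ = refine-hereditary (Independent-⊑ (⊑-refl {R})) indR ∷ refine-pairwise indSs indRs
... | no _  = AllPairs.++⁺ (clip-pairwise R indSs) indRs
                (All.map (λ T⊑R → All.map (λ {R′} → Independent-⊑ T⊑R (⊑-refl {R′})) indR) (clip-⊑ Ss R))

refine-covers : ∀ {L Ss Rs x y} → Any (λ R → Contains R x y) Rs → Any (λ S → Contains S x y) Ss →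
  Any (λ T → Contains T x y) (refine L Ss Rs)
refine-covers {L} {Ss} {R ∷ Rs} inRs inSs with avoids? R L | inRs
... | yes _ | here inR    = here inR
... | yes _ | there inRs′ = there (refine-covers inRs′ inSs)
... | no _  | here inR    = Any.++⁺ˡ (clip-covers inR inSs)
... | no _  | there inRs′ = Any.++⁺ʳ (clip Ss R) inRs′

∣p∪q∣≤∣p∣+∣q∣ : ∀ {n} (p q : Subset n) → ∣ p ∪ q ∣ ≤ ∣ p ∣ + ∣ q ∣
∣p∪q∣≤∣p∣+∣q∣ []          []          = z≤n
∣p∪q∣≤∣p∣+∣q∣ (true ∷ p)  (true ∷ q)  = s≤s (≤-trans (∣p∪q∣≤∣p∣+∣q∣ p q) (+-monoʳ-≤ ∣ p ∣ (n≤1+n _)))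
∣p∪q∣≤∣p∣+∣q∣ (true ∷ p)  (false ∷ q) = s≤s (∣p∪q∣≤∣p∣+∣q∣ p q)
∣p∪q∣≤∣p∣+∣q∣ (false ∷ p) (true ∷ q)  = ≤-trans (s≤s (∣p∪q∣≤∣p∣+∣q∣ p q)) (≤-reflexive (sym (+-suc _ _)))
∣p∪q∣≤∣p∣+∣q∣ (false ∷ p) (false ∷ q) = ∣p∪q∣≤∣p∣+∣q∣ p q

CoverableAvoiding-mono : ∀ {n} {π : Perm n} {Ls k k′ s s′} → k ≤ k′ → s ≤ s′ →
  CoverableAvoiding π Ls k s → CoverableAvoiding π Ls k′ s′
CoverableAvoiding-mono k≤k′ s≤s′ (Rs , |Rs|≤k , ind , avoid , E , |E|≤s , cover) =
  Rs , ≤-trans |Rs|≤k k≤k′ , ind , avoid , E , ≤-trans |E|≤s s≤s′ , cover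

CoverableAvoiding-[] : ∀ {n} (π : Perm n) → CoverableAvoiding π [] 1 0
CoverableAvoiding-[] {n} π =
  [ rect 0 n 0 n z≤n z≤n ] , ≤-refl , [] ∷ [] , [] ∷ [] , ⊥ , ≤-reflexive (∣⊥∣≡0 n) ,
  λ i _ → here ((z≤n , toℕ≤n i) , (z≤n , toℕ≤n (π ⟨$⟩ʳ i)))

CoverableAvoiding-∷ : ∀ {n} {π : Perm n} {L Ls k q s t} →
  CoverableAvoiding π Ls k s → CoverableAvoiding π [ L ] q t →
  CoverableAvoiding π (L ∷ Ls) (k + (q ∸ 1)) (t + s)
CoverableAvoiding-∷ {q = q} (Rs , |Rs|≤k , indRs , avoidRs , E , |E|≤s , coverRs)
                            (Ss , |Ss|≤q , indSs , avoidSs , F , |F|≤t , coverSs) =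
  refine _ Ss Rs ,
  ≤-trans (refine-length Rs |Ss|≤q) (+-monoˡ-≤ (q ∸ 1) |Rs|≤k) ,
  refine-pairwise indSs indRs ,
  All.zipWith (uncurry _∷_)
    ( refine-avoids (All.map All.head avoidSs) indRs
    , refine-hereditary (λ T⊑R → All.map (Avoids-⊑ _ T⊑R)) avoidRs) ,
  F ∪ E ,
  ≤-trans (∣p∪q∣≤∣p∣+∣q∣ F E) (+-mono-≤ |F|≤t |E|≤s) ,
  λ i i∉F∪E → refine-covers (coverRs i (i∉F∪E ∘ x∈p∪q⁺ ∘ inj₂)) (coverSs i (i∉F∪E ∘ x∈p∪q⁺ ∘ inj₁))

-- The bound also holds for ℓ = 0.
Concentrated⇒CoverableAvoiding : ∀ {n q r} {π : Perm n} → Concentrated q r π →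
  (𝔏 : List Line) → CoverableAvoiding π 𝔏 ((q ∸ 1) * length 𝔏 + 1) (r * length 𝔏)
Concentrated⇒CoverableAvoiding {q = q} {r} {π} _ [] =
  CoverableAvoiding-mono {π = π} {Ls = []} (≤-reflexive (cong (_+ 1) (sym (*-zeroʳ (q ∸ 1))))) z≤n
    (CoverableAvoiding-[] π)
Concentrated⇒CoverableAvoiding {q = q} {r} {π} conc (L ∷ Ls) =
  CoverableAvoiding-mono {π = π} {Ls = L ∷ Ls}
    (≤-reflexive (shift (q ∸ 1) (length Ls))) (≤-reflexive (sym (*-suc r (length Ls))))
    (CoverableAvoiding-∷ {π = π} {L} {Ls} (Concentrated⇒CoverableAvoiding {π = π} conc Ls) (conc L))
  where
  shift : ∀ a ℓ → a * ℓ + 1 + a ≡ a * suc ℓ + 1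
  shift = solve-∀

proposition5p8 : (q r : ℕ) → (𝒞 : PermClass) → ConcentratedClass q r 𝒞 →
    ∀ {n} (π : Perm n) → member 𝒞 π →
    (𝔏 : List Line) → 1 ≤ length 𝔏 →
    CoverableAvoiding π 𝔏 ((q ∸ 1) * length 𝔏 + 1) (r * length 𝔏)
proposition5p8 q r 𝒞 concentrated π π∈𝒞 𝔏 _ =
  Concentrated⇒CoverableAvoiding {π = π} (concentrated π π∈𝒞) 𝔏
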